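{- For $n\geq 1$ and $0\leq m<n$, $S_{n,m}(0010,0021)=S_{n,m}(0011,0021)$.
   Context: An ascent in a sequence $x_1\cdots x_k$ is an index $j\ge1$ with $x_j<x_{j+1}$; $\mathrm{asc}$ counts ascents. An ascent sequence of length $n$ is a sequence $x_1\cdots x_n$ of non-negative integers with $x_1=0$ and $x_i\leq \mathrm{asc}(x_1\cdots x_{i-1})+1$ for $1<i\le n$. A sequence $\pi$ contains a pattern $\tau=\tau_1\cdots\tau_k$ (finite sequence of non-negative integers) if some subsequence $\pi_{f(1)}\cdots\pi_{f(k)}$ ($f$ strictly increasing) satisfies $\pi_{f(i)}<\pi_{f(j)}$ iff $\tau_i<\tau_j$ and $\pi_{f(i)}>\pi_{f(j)}$ iff $\tau_i>\tau_j$ for all $i,j$; otherwise $\pi$ avoids $\tau$. $S_{n,m}(u,v)$ is the number of ascent sequences of length $n$ with exactly $m$ ascents avoiding both patterns $u$ and $v$. -}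

module Defs where

open import Data.Nat using (ℕ; zero; suc; _+_; _<ᵇ_; _≡ᵇ_)
open import Data.Bool using (Bool; true; false; _∧_; _∨_; not; if_then_else_)
open import Data.List using (List; []; _∷_; length; filter; map; concatMap; upTo; _++_)
open import Data.Bool.ListAction using (any)
open import Relation.Nullary.Decidable using (Dec)
open import Data.Bool.Properties using (T?)

_⇔ᵇ_ : Bool → Bool → Bool
true  ⇔ᵇ b = b
false ⇔ᵇ b = not b

asc : List ℕ → ℕ
asc []           = 0
asc (x ∷ [])     = 0
asc (x ∷ y ∷ xs) = (if x <ᵇ y then 1 else 0) + asc (y ∷ xs)

-- Auxiliary check: every further element x_i satisfies x_i ≤ asc(prefix) + 1,
-- where `prev` is the previous element and `a` the number of ascents so far.
ascentTail : ℕ → ℕ → List ℕ → Bool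
ascentTail prev a []       = true
ascentTail prev a (x ∷ xs) =
  (x <ᵇ suc (suc a)) ∧ ascentTail x (if prev <ᵇ x then suc a else a) xs

-- x_1 ⋯ x_n is an ascent sequence: x_1 = 0 and x_i ≤ asc(x_1 ⋯ x_{i-1}) + 1 for 1 < i ≤ n.
-- (The empty list is not an ascent sequence, since x_1 = 0 is required.)
isAscentSeq : List ℕ → Bool
isAscentSeq []       = false
isAscentSeq (x ∷ xs) = (x ≡ᵇ 0) ∧ ascentTail x 0 xs

allLists : ℕ → ℕ → List (List ℕ)
allLists zero    b = [] ∷ []
allLists (suc n) b = concatMap (λ x → map (x ∷_) (allLists n b)) (upTo b)

subseqs : ℕ → List ℕ → List (List ℕ)
subseqs zero    xs       = [] ∷ []
subseqs (suc k) []       = []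
subseqs (suc k) (x ∷ xs) = map (x ∷_) (subseqs k xs) ++ subseqs (suc k) xs

-- Order-isomorphism of two sequences: same length, and for all i, j:
-- s_i < s_j iff t_i < t_j and s_i > s_j iff t_i > t_j.
-- (Checked for all pairs i < j in both directions, which covers all i, j.)
orderIso : List ℕ → List ℕ → Bool
orderIso []       []       = true
orderIso []       (_ ∷ _)  = false
orderIso (_ ∷ _)  []       = false
orderIso (s ∷ ss) (t ∷ ts) = pairs ss ts ∧ orderIso ss ts
  where
  pairs : List ℕ → List ℕ → Bool
  pairs []       []       = true
  pairs []       (_ ∷ _)  = false
  pairs (_ ∷ _)  []       = false
  pairs (u ∷ us) (w ∷ ws) =
    ((s <ᵇ u) ⇔ᵇ (t <ᵇ w)) ∧ ((u <ᵇ s) ⇔ᵇ (w <ᵇ t)) ∧ pairs us ws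

contains : List ℕ → List ℕ → Bool
contains π τ = any (λ σ → orderIso σ τ) (subseqs (length τ) π)

-- Every ascent sequence of length n has entries
-- x_i ≤ i - 1 < n, so enumerating lists of length n with entries < n is exhaustive.
S : ℕ → ℕ → List ℕ → List ℕ → ℕ
S n m u v = length (filter (λ x → T? (isAscentSeq x ∧ (asc x ≡ᵇ m)
                                      ∧ not (contains x u) ∧ not (contains x v)))
                           (allLists n n))

-- Grow ascent sequences one letter at a time. Appending x to a prefix s creates 0010 or 0021
-- iff s contains c c e with c ≤ x < e, and creates 0011 or 0021 iff c < x ≤ e; so the letters
-- forbidden in the second class are those forbidden in the first, shifted up by one. Send an
-- allowed letter x of the first class to the bottom w of the run of forbidden letters just
-- below it. Then w is allowed in the second class, appending w makes an ascent iff appending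
-- x does, and the two extended prefixes again have the same forbidden letters. Letter by
-- letter this is a bijection between the two generating trees, up to branches that die
-- immediately, and it preserves the number of ascents.

module Submission where

open import Defs
open import Data.Nat using (ℕ; _≤_; _<_)
open import Data.List using (List; []; _∷_)
open import Relation.Binary.PropositionalEquality using (_≡_)

open import Data.Bool using (Bool; true; false; _∧_; _∨_; not; if_then_else_)
open import Data.Bool.Properties
  using (T?; ¬-not; T-≡; ∧-zeroʳ; ∨-identityʳ; ∨-assoc; ∧-assoc; ∧-identityʳ; ∧-distribʳ-∨;
         ∨-commutativeMonoid; not-involutive; ∨-zeroʳ)
open import Data.Bool.ListAction using (any; or)
open import Data.Empty using (⊥; ⊥-elim)
open import Data.Product using (_×_; _,_; proj₁; proj₂)
open import Data.Sum using (_⊎_; inj₁; inj₂)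
open import Data.List using (_∷ʳ_; _++_; map; length; filter; concat; upTo)
open import Data.List.Reverse using (Reverse; []; _∶_∶ʳ_; reverseView)
open import Data.List.Properties using (length-++-sucʳ; map-∘; map-cong; map-++; ++-assoc; ++-identityʳ; upTo-∷ʳ)
open import Data.Nat.ListAction using (sum)
open import Data.Nat.ListAction.Properties using (sum-++)
open import Data.Nat using (_≰_; _≮_; zero; suc; _+_; _∸_; z≤n; s≤s⁻¹; _<ᵇ_; _≡ᵇ_; z<s; s<s)
open import Data.Nat.Properties
  using (_≟_; 1+n≢0; +-monoʳ-≤; +-monoˡ-≤; m<m+n; ≤∧≢⇒<; m≤m+n; ≤-<-trans; ≰⇒>; ≤-reflexive;
         ≤-trans; <⇒<ᵇ; <ᵇ⇒<; ≡ᵇ⇒≡; ≤⇒≯; ≮⇒≥; ≤-refl; m≤n⇒m≤1+n; <-≤-trans; m≤n⇒m<n∨m≡n;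
         +-identityʳ; +-assoc; +-suc; <-irrefl; <-trans; suc-injective)
open import Function using (_∘_; Equivalence)
open import Relation.Nullary using (yes; no)
open import Relation.Binary.PropositionalEquality using (refl; sym; trans; cong; cong₂; _≢_; _≗_; subst; subst₂; module ≡-Reasoning)
open ≡-Reasoning

open import Algebra.Bundles using (module CommutativeMonoid)
open import Algebra.Properties.CommutativeSemigroup (CommutativeMonoid.commutativeSemigroup ∨-commutativeMonoid)
  using (interchange)

∨-interchange : ∀ a b c d → ((a ∨ b) ∨ (c ∨ d)) ≡ ((a ∨ c) ∨ (b ∨ d))
∨-interchange = interchange

true≢false : true ≢ false
true≢false ()

∨-true : ∀ {a b} → (a ∨ b) ≡ true → a ≡ true ⊎ b ≡ true
∨-true {true}  _  = inj₁ refl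
∨-true {false} eq = inj₂ eq

∧-true : ∀ {a b} → (a ∧ b) ≡ true → a ≡ true × b ≡ true
∧-true {true} eq = refl , eq

∨-false : ∀ {a b} → (a ∨ b) ≡ false → a ≡ false
∨-false {false} _ = refl

∨-congʳ-false : ∀ {a b c} → (a ≡ false → b ≡ c) → (a ∨ b) ≡ (a ∨ c)
∨-congʳ-false {true}  _     = refl
∨-congʳ-false {false} b≡c = b≡c refl

not-true : ∀ {b} → not b ≡ true → b ≡ false
not-true {false} _ = refl

∧-not-true : ∀ {a b} → b ≡ true → (a ∧ not b) ≡ false
∧-not-true {a} refl = ∧-zeroʳ a

indicator : Bool → ℕ
indicator b = if b then 1 else 0

-- A Boolean form of <-cmp: matching on it also fixes m <ᵇ n and n <ᵇ m,
-- so that Boolean definitions such as orderIso compute in each case.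
data Comparisonᵇ (m n : ℕ) : Bool → Bool → Set where
  less    : m < n → Comparisonᵇ m n true  false
  equal   : m ≡ n → Comparisonᵇ m n false false
  greater : n < m → Comparisonᵇ m n false true

compareᵇ : ∀ m n → Comparisonᵇ m n (m <ᵇ n) (n <ᵇ m)
compareᵇ zero    zero    = equal refl
compareᵇ zero    (suc n) = less z<s
compareᵇ (suc m) zero    = greater z<s
compareᵇ (suc m) (suc n) with m <ᵇ n | n <ᵇ m | compareᵇ m n
... | _ | _ | less m<n    = less (s<s m<n)
... | _ | _ | equal m≡n   = equal (cong suc m≡n)
... | _ | _ | greater n<m = greater (s<s n<m)

<ᵇ-irrefl : ∀ n → (n <ᵇ n) ≡ false
<ᵇ-irrefl zero    = refl
<ᵇ-irrefl (suc n) = <ᵇ-irrefl n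

≡ᵇ-refl : ∀ n → (n ≡ᵇ n) ≡ true
≡ᵇ-refl zero    = refl
≡ᵇ-refl (suc n) = ≡ᵇ-refl n

<ᵇ-suc : ∀ m n → (m <ᵇ suc n) ≡ not (n <ᵇ m)
<ᵇ-suc zero    n       = refl
<ᵇ-suc (suc m) zero    = refl
<ᵇ-suc (suc m) (suc n) = <ᵇ-suc m n

<ᵇ-true : ∀ {m n} → m < n → (m <ᵇ n) ≡ true
<ᵇ-true m<n = Equivalence.to T-≡ (<⇒<ᵇ m<n)

<ᵇ-true⁻¹ : ∀ {m n} → (m <ᵇ n) ≡ true → m < n
<ᵇ-true⁻¹ {m} {n} eq = <ᵇ⇒< m n (Equivalence.from T-≡ eq)

<ᵇ-false : ∀ {m n} → n ≤ m → (m <ᵇ n) ≡ false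
<ᵇ-false n≤m = ¬-not (λ eq → ≤⇒≯ n≤m (<ᵇ-true⁻¹ eq))

<ᵇ-false⁻¹ : ∀ {m n} → (m <ᵇ n) ≡ false → n ≤ m
<ᵇ-false⁻¹ eq = ≮⇒≥ (λ m<n → true≢false (trans (sym (<ᵇ-true m<n)) eq))

≡ᵇ-false : ∀ {m n} → m ≢ n → (m ≡ᵇ n) ≡ false
≡ᵇ-false {m} {n} m≢n = ¬-not (λ eq → m≢n (≡ᵇ⇒≡ m n (Equivalence.from T-≡ eq)))

module _ {A : Set} where

  any-++ : ∀ (p : A → Bool) xs ys → any p (xs ++ ys) ≡ (any p xs ∨ any p ys)
  any-++ p []       ys = refl
  any-++ p (x ∷ xs) ys = trans (cong (p x ∨_) (any-++ p xs ys)) (sym (∨-assoc (p x) _ _))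

  any-map : ∀ {B : Set} (p : B → Bool) (f : A → B) xs → any p (map f xs) ≡ any (p ∘ f) xs
  any-map p f xs = cong or (sym (map-∘ xs))

  any-cong : ∀ {p q : A → Bool} → p ≗ q → ∀ xs → any p xs ≡ any q xs
  any-cong p≗q xs = cong or (map-cong p≗q xs)

  any-false : ∀ {p : A → Bool} → (∀ x → p x ≡ false) → ∀ xs → any p xs ≡ false
  any-false p≡false []       = refl
  any-false p≡false (x ∷ xs) rewrite p≡false x = any-false p≡false xs

  any-∨ : ∀ (p q : A → Bool) xs → (any p xs ∨ any q xs) ≡ any (λ x → p x ∨ q x) xs
  any-∨ p q []       = refl
  any-∨ p q (x ∷ xs) = trans (∨-interchange (p x) (any p xs) (q x) (any q xs)) (cong (_ ∨_) (any-∨ p q xs))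

  any-∧ʳ : ∀ (p : A → Bool) b xs → any (λ x → p x ∧ b) xs ≡ (any p xs ∧ b)
  any-∧ʳ p b []       = refl
  any-∧ʳ p b (x ∷ xs) = trans (cong (p x ∧ b ∨_) (any-∧ʳ p b xs)) (sym (∧-distribʳ-∨ b (p x) (any p xs)))

any-subseqs-∷ : ∀ (p : List ℕ → Bool) k y s →
  any p (subseqs (suc k) (y ∷ s)) ≡ (any (p ∘ (y ∷_)) (subseqs k s) ∨ any p (subseqs (suc k) s))
any-subseqs-∷ p k y s =
  trans (any-++ p (map (y ∷_) (subseqs k s)) (subseqs (suc k) s)) (cong (_∨ _) (any-map p (y ∷_) (subseqs k s)))

any-subseqs-∷ʳ : ∀ k s x (p : List ℕ → Bool) →
  any p (subseqs (suc k) (s ∷ʳ x)) ≡ (any p (subseqs (suc k) s) ∨ any (p ∘ (_∷ʳ x)) (subseqs k s))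
any-subseqs-∷ʳ zero    []      x p = refl
any-subseqs-∷ʳ (suc k) []      x p = refl
any-subseqs-∷ʳ zero    (y ∷ s) x p = begin
  any p (subseqs 1 (y ∷ s ∷ʳ x))
    ≡⟨ any-subseqs-∷ p 0 y (s ∷ʳ x) ⟩
  (p (y ∷ []) ∨ false) ∨ any p (subseqs 1 (s ∷ʳ x))
    ≡⟨ cong (_ ∨_) (any-subseqs-∷ʳ zero s x p) ⟩
  (p (y ∷ []) ∨ false) ∨ (any p (subseqs 1 s) ∨ (p (x ∷ []) ∨ false))
    ≡⟨ ∨-assoc (p (y ∷ []) ∨ false) (any p (subseqs 1 s)) (p (x ∷ []) ∨ false) ⟨
  ((p (y ∷ []) ∨ false) ∨ any p (subseqs 1 s)) ∨ (p (x ∷ []) ∨ false)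
    ≡⟨ cong (_∨ _) (any-subseqs-∷ p 0 y s) ⟨
  any p (subseqs 1 (y ∷ s)) ∨ (p (x ∷ []) ∨ false)
    ∎
any-subseqs-∷ʳ (suc k) (y ∷ s) x p = begin
  any p (subseqs (2 + k) (y ∷ s ∷ʳ x))
    ≡⟨ any-subseqs-∷ p (suc k) y (s ∷ʳ x) ⟩
  any (p ∘ (y ∷_)) (subseqs (suc k) (s ∷ʳ x)) ∨ any p (subseqs (2 + k) (s ∷ʳ x))
    ≡⟨ cong₂ _∨_ (any-subseqs-∷ʳ k s x (p ∘ (y ∷_))) (any-subseqs-∷ʳ (suc k) s x p) ⟩
  (withY ∨ withYX) ∨ (withoutY ∨ withoutYX)
    ≡⟨ ∨-interchange withY withYX withoutY withoutYX ⟩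
  (withY ∨ withoutY) ∨ (withYX ∨ withoutYX)
    ≡⟨ cong₂ _∨_ (any-subseqs-∷ p (suc k) y s) (any-subseqs-∷ (p ∘ (_∷ʳ x)) k y s) ⟨
  any p (subseqs (2 + k) (y ∷ s)) ∨ any (p ∘ (_∷ʳ x)) (subseqs (suc k) (y ∷ s))
    ∎
  where
  withY withYX withoutY withoutYX : Bool
  withY     = any (p ∘ (y ∷_)) (subseqs (suc k) s)
  withYX    = any (p ∘ (y ∷_) ∘ (_∷ʳ x)) (subseqs k s)
  withoutY  = any p (subseqs (2 + k) s)
  withoutYX = any (p ∘ (_∷ʳ x)) (subseqs (suc k) s)

any-either-subseqs-∷ʳ : ∀ k s x (p q f : List ℕ → Bool) → (∀ t → (p (t ∷ʳ x) ∨ q (t ∷ʳ x)) ≡ f t) →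
  (any p (subseqs (suc k) (s ∷ʳ x)) ∨ any q (subseqs (suc k) (s ∷ʳ x))) ≡
  ((any p (subseqs (suc k) s) ∨ any q (subseqs (suc k) s)) ∨ any f (subseqs k s))
any-either-subseqs-∷ʳ k s x p q f p∨q≡f = begin
  any p (subseqs (suc k) (s ∷ʳ x)) ∨ any q (subseqs (suc k) (s ∷ʳ x))
    ≡⟨ cong₂ _∨_ (any-subseqs-∷ʳ k s x p) (any-subseqs-∷ʳ k s x q) ⟩
  (any p (subseqs (suc k) s) ∨ any (p ∘ (_∷ʳ x)) (subseqs k s)) ∨
  (any q (subseqs (suc k) s) ∨ any (q ∘ (_∷ʳ x)) (subseqs k s))
    ≡⟨ ∨-interchange (any p (subseqs (suc k) s)) _ (any q (subseqs (suc k) s)) _ ⟩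
  (any p (subseqs (suc k) s) ∨ any q (subseqs (suc k) s)) ∨
  (any (p ∘ (_∷ʳ x)) (subseqs k s) ∨ any (q ∘ (_∷ʳ x)) (subseqs k s))
    ≡⟨ cong (_ ∨_) (trans (any-∨ _ _ (subseqs k s)) (any-cong p∨q≡f (subseqs k s))) ⟩
  (any p (subseqs (suc k) s) ∨ any q (subseqs (suc k) s)) ∨ any f (subseqs k s)
    ∎

-- Forbidden letters

p0010 p0011 p0021 : List ℕ
p0010 = 0 ∷ 0 ∷ 1 ∷ 0 ∷ []
p0011 = 0 ∷ 0 ∷ 1 ∷ 1 ∷ []
p0021 = 0 ∷ 0 ∷ 2 ∷ 1 ∷ []

isPatternA isPatternB : List ℕ → Bool
isPatternA w = orderIso w p0010 ∨ orderIso w p0021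
isPatternB w = orderIso w p0011 ∨ orderIso w p0021

orderIso-length : ∀ s t → length s ≢ length t → orderIso s t ≡ false
orderIso-length []      []      ne = ⊥-elim (ne refl)
orderIso-length []      (_ ∷ _) ne = refl
orderIso-length (_ ∷ _) []      ne = refl
orderIso-length (u ∷ s) (w ∷ t) ne rewrite orderIso-length s t (ne ∘ cong suc) = ∧-zeroʳ _

completesA completesB : List ℕ → ℕ → Bool
completesA (c ∷ d ∷ e ∷ []) x = (c ≡ᵇ d) ∧ (not (x <ᵇ c) ∧ (x <ᵇ e))
completesA _                _ = false
completesB (c ∷ d ∷ e ∷ []) x = (c ≡ᵇ d) ∧ ((c <ᵇ x) ∧ not (e <ᵇ x))
completesB _                _ = false

windows-with-repeat : ∀ c e x →
  isPatternA (c ∷ c ∷ e ∷ x ∷ []) ≡ completesA (c ∷ c ∷ e ∷ []) x ×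
  isPatternB (c ∷ c ∷ e ∷ x ∷ []) ≡ completesB (c ∷ c ∷ e ∷ []) x
windows-with-repeat c e x rewrite <ᵇ-irrefl c | ≡ᵇ-refl c
  with c <ᵇ e | e <ᵇ c | c <ᵇ x | x <ᵇ c | e <ᵇ x | x <ᵇ e
     | compareᵇ c e | compareᵇ c x | compareᵇ e x
... | _ | _ | _ | _ | _ | _ | less _ | less _ | less _ = refl , refl
... | _ | _ | _ | _ | _ | _ | less _ | less _ | equal _ = refl , refl
... | _ | _ | _ | _ | _ | _ | less _ | less _ | greater _ = refl , refl
... | _ | _ | _ | _ | _ | _ | less _ | equal _ | less _ = refl , refl
... | _ | _ | _ | _ | _ | _ | less _ | equal _ | equal _ = refl , refl
... | _ | _ | _ | _ | _ | _ | less _ | equal _ | greater _ = refl , refl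
... | _ | _ | _ | _ | _ | _ | less _ | greater _ | less _ = refl , refl
... | _ | _ | _ | _ | _ | _ | less _ | greater _ | equal _ = refl , refl
... | _ | _ | _ | _ | _ | _ | less _ | greater _ | greater _ = refl , refl
... | _ | _ | _ | _ | _ | _ | equal _ | less _ | less _ = refl , refl
... | _ | _ | _ | _ | _ | _ | equal c≡e | less c<x | equal e≡x = ⊥-elim (<-irrefl (trans c≡e e≡x) c<x)
... | _ | _ | _ | _ | _ | _ | equal c≡e | less c<x | greater x<e = ⊥-elim (<-irrefl c≡e (<-trans c<x x<e))
... | _ | _ | _ | _ | _ | _ | equal _ | equal _ | less _ = refl , refl
... | _ | _ | _ | _ | _ | _ | equal _ | equal _ | equal _ = refl , refl
... | _ | _ | _ | _ | _ | _ | equal c≡e | equal c≡x | greater x<e = ⊥-elim (<-irrefl (trans (sym c≡x) c≡e) x<e)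
... | _ | _ | _ | _ | _ | _ | equal _ | greater _ | less _ = refl , refl
... | _ | _ | _ | _ | _ | _ | equal _ | greater _ | equal _ = refl , refl
... | _ | _ | _ | _ | _ | _ | equal _ | greater _ | greater _ = refl , refl
... | _ | _ | _ | _ | _ | _ | greater _ | less _ | less _ = refl , refl
... | _ | _ | _ | _ | _ | _ | greater e<c | less c<x | equal e≡x = ⊥-elim (<-irrefl e≡x (<-trans e<c c<x))
... | _ | _ | _ | _ | _ | _ | greater e<c | less c<x | greater x<e = ⊥-elim (<-irrefl refl (<-trans (<-trans e<c c<x) x<e))
... | _ | _ | _ | _ | _ | _ | greater _ | equal _ | less _ = refl , refl
... | _ | _ | _ | _ | _ | _ | greater _ | equal _ | equal _ = refl , refl
... | _ | _ | _ | _ | _ | _ | greater e<c | equal c≡x | greater x<e = ⊥-elim (<-irrefl (sym c≡x) (<-trans x<e e<c))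
... | _ | _ | _ | _ | _ | _ | greater _ | greater _ | less _ = refl , refl
... | _ | _ | _ | _ | _ | _ | greater _ | greater _ | equal _ = refl , refl
... | _ | _ | _ | _ | _ | _ | greater _ | greater _ | greater _ = refl , refl

windows-without-repeat : ∀ {c d e x} → c ≢ d →
  isPatternA (c ∷ d ∷ e ∷ x ∷ []) ≡ completesA (c ∷ d ∷ e ∷ []) x ×
  isPatternB (c ∷ d ∷ e ∷ x ∷ []) ≡ completesB (c ∷ d ∷ e ∷ []) x
windows-without-repeat {c} {d} c≢d rewrite ≡ᵇ-false c≢d with c <ᵇ d | d <ᵇ c | compareᵇ c d
... | _ | _ | less _    = refl , refl
... | _ | _ | equal c≡d = ⊥-elim (c≢d c≡d)
... | _ | _ | greater _ = refl , refl

patterns-of-wrong-length : ∀ s → length s ≢ 4 →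
  isPatternA s ≡ false × isPatternB s ≡ false
patterns-of-wrong-length s ne
  rewrite orderIso-length s p0010 ne | orderIso-length s p0011 ne | orderIso-length s p0021 ne = refl , refl

patterns-ending-in : ∀ t x →
  isPatternA (t ∷ʳ x) ≡ completesA t x ×
  isPatternB (t ∷ʳ x) ≡ completesB t x
patterns-ending-in []                    x = refl , refl
patterns-ending-in (c ∷ [])              x = patterns-of-wrong-length (c ∷ x ∷ []) (λ ())
patterns-ending-in (c ∷ d ∷ [])          x = patterns-of-wrong-length (c ∷ d ∷ x ∷ []) (λ ())
patterns-ending-in (c ∷ d ∷ e ∷ [])      x with c ≟ d
... | yes refl = windows-with-repeat c e x
... | no  c≢d  = windows-without-repeat c≢d
patterns-ending-in (c ∷ d ∷ e ∷ f ∷ t) x = patterns-of-wrong-length ((c ∷ d ∷ e ∷ f ∷ t) ∷ʳ x)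
  (λ eq → 1+n≢0 (trans (sym (length-++-sucʳ t x [])) (cong (_∸ 4) eq)))

containsA containsB : List ℕ → Bool
containsA s = contains s p0010 ∨ contains s p0021
containsB s = contains s p0011 ∨ contains s p0021

forbiddenA forbiddenB : List ℕ → ℕ → Bool
forbiddenA s v = any (λ t → completesA t v) (subseqs 3 s)
forbiddenB s v = any (λ t → completesB t v) (subseqs 3 s)

containsA-∷ʳ : ∀ s x → containsA (s ∷ʳ x) ≡ (containsA s ∨ forbiddenA s x)
containsA-∷ʳ s x = any-either-subseqs-∷ʳ 3 s x _ _ _ (λ t → proj₁ (patterns-ending-in t x))

containsB-∷ʳ : ∀ s x → containsB (s ∷ʳ x) ≡ (containsB s ∨ forbiddenB s x)
containsB-∷ʳ s x = any-either-subseqs-∷ʳ 3 s x _ _ _ (λ t → proj₂ (patterns-ending-in t x))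

isValue isRepeatAtMost : List ℕ → ℕ → Bool
isValue (c ∷ []) v = c ≡ᵇ v
isValue _        _ = false
isRepeatAtMost (c ∷ d ∷ []) v = (c ≡ᵇ d) ∧ not (v <ᵇ c)
isRepeatAtMost _            _ = false

occurs repeatedAtMost : List ℕ → ℕ → Bool
occurs         s v = any (λ t → isValue t v) (subseqs 1 s)
repeatedAtMost s v = any (λ t → isRepeatAtMost t v) (subseqs 2 s)

completesA-∷ʳ : ∀ t x v → completesA (t ∷ʳ x) v ≡ (isRepeatAtMost t v ∧ (v <ᵇ x))
completesA-∷ʳ []                  x v = refl
completesA-∷ʳ (c ∷ [])            x v = refl
completesA-∷ʳ (c ∷ d ∷ [])        x v = sym (∧-assoc (c ≡ᵇ d) _ _)
completesA-∷ʳ (c ∷ d ∷ e ∷ [])    x v = refl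
completesA-∷ʳ (c ∷ d ∷ e ∷ f ∷ t) x v = refl

isRepeatAtMost-∷ʳ : ∀ t x v → isRepeatAtMost (t ∷ʳ x) v ≡ (isValue t x ∧ not (v <ᵇ x))
isRepeatAtMost-∷ʳ []              x v = refl
isRepeatAtMost-∷ʳ (c ∷ [])        x v with c ≟ x
... | yes refl = refl
... | no  c≢x  rewrite ≡ᵇ-false c≢x = refl
isRepeatAtMost-∷ʳ (c ∷ d ∷ [])     x v = refl
isRepeatAtMost-∷ʳ (c ∷ d ∷ e ∷ t) x v = refl

forbiddenA-∷ʳ : ∀ s x v → forbiddenA (s ∷ʳ x) v ≡ (forbiddenA s v ∨ (repeatedAtMost s v ∧ (v <ᵇ x)))
forbiddenA-∷ʳ s x v = trans (any-subseqs-∷ʳ 2 s x _) (cong (forbiddenA s v ∨_)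
  (trans (any-cong (λ t → completesA-∷ʳ t x v) (subseqs 2 s)) (any-∧ʳ _ (v <ᵇ x) (subseqs 2 s))))

repeatedAtMost-∷ʳ : ∀ s x v → repeatedAtMost (s ∷ʳ x) v ≡ (repeatedAtMost s v ∨ (occurs s x ∧ not (v <ᵇ x)))
repeatedAtMost-∷ʳ s x v = trans (any-subseqs-∷ʳ 1 s x _) (cong (repeatedAtMost s v ∨_)
  (trans (any-cong (λ t → isRepeatAtMost-∷ʳ t x v) (subseqs 1 s)) (any-∧ʳ _ (not (v <ᵇ x)) (subseqs 1 s))))

occurs-∷ʳ : ∀ s x v → occurs (s ∷ʳ x) v ≡ (occurs s v ∨ (x ≡ᵇ v))
occurs-∷ʳ s x v = trans (any-subseqs-∷ʳ 0 s x _) (cong (occurs s v ∨_) (∨-identityʳ (x ≡ᵇ v)))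

forbiddenB-suc : ∀ s v → forbiddenB s (suc v) ≡ forbiddenA s v
forbiddenB-suc s v = any-cong completesB-suc (subseqs 3 s)
  where
  completesB-suc : ∀ t → completesB t (suc v) ≡ completesA t v
  completesB-suc (c ∷ d ∷ e ∷ []) rewrite <ᵇ-suc c v | <ᵇ-suc e v | not-involutive (v <ᵇ e) = refl
  completesB-suc []                  = refl
  completesB-suc (_ ∷ [])            = refl
  completesB-suc (_ ∷ _ ∷ [])        = refl
  completesB-suc (_ ∷ _ ∷ _ ∷ _ ∷ _) = refl

forbiddenB-zero : ∀ s → forbiddenB s 0 ≡ false
forbiddenB-zero s = any-false completesB-zero (subseqs 3 s)
  where
  completesB-zero : ∀ t → completesB t 0 ≡ false
  completesB-zero (c ∷ d ∷ e ∷ []) = ∧-zeroʳ (c ≡ᵇ d)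
  completesB-zero []                  = refl
  completesB-zero (_ ∷ [])            = refl
  completesB-zero (_ ∷ _ ∷ [])        = refl
  completesB-zero (_ ∷ _ ∷ _ ∷ _ ∷ _) = refl

repeatedAtMost-mono : ∀ s {u v} → u ≤ v → repeatedAtMost s u ≡ true → repeatedAtMost s v ≡ true
repeatedAtMost-mono s {u} {v} u≤v = go (reverseView s)
  where
  go : ∀ {s} → Reverse s → repeatedAtMost s u ≡ true → repeatedAtMost s v ≡ true
  go []            ()
  go (s ∶ rs ∶ʳ x) repeated with ∨-true (trans (sym (repeatedAtMost-∷ʳ s x u)) repeated)
  ... | inj₁ earlier = trans (repeatedAtMost-∷ʳ s x v) (cong (_∨ (occurs s x ∧ not (v <ᵇ x))) (go rs earlier))
  ... | inj₂ last with ∧-true last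
  ...   | x∈s , u≮x = trans (repeatedAtMost-∷ʳ s x v)
    (trans (cong₂ (λ o l → repeatedAtMost s v ∨ (o ∧ not l)) x∈s v≮x) (∨-zeroʳ (repeatedAtMost s v)))
    where
    v≮x : (v <ᵇ x) ≡ false
    v≮x = <ᵇ-false (≤-trans (<ᵇ-false⁻¹ {u} {x} (not-true u≮x)) u≤v)

repeatedAtMost-antimono : ∀ s {u v} → u ≤ v → repeatedAtMost s v ≡ false → repeatedAtMost s u ≡ false
repeatedAtMost-antimono s u≤v none = ¬-not (λ some → true≢false (trans (sym (repeatedAtMost-mono s u≤v some)) none))

forbiddenA⇒repeatedAtMost : ∀ s {v} → forbiddenA s v ≡ true → repeatedAtMost s v ≡ true
forbiddenA⇒repeatedAtMost s {v} = go (reverseView s)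
  where
  go : ∀ {s} → Reverse s → forbiddenA s v ≡ true → repeatedAtMost s v ≡ true
  go []            ()
  go (s ∶ rs ∶ʳ x) forbidden with ∨-true (trans (sym (forbiddenA-∷ʳ s x v)) forbidden)
  ... | inj₁ earlier = trans (repeatedAtMost-∷ʳ s x v) (cong (_∨ (occurs s x ∧ not (v <ᵇ x))) (go rs earlier))
  ... | inj₂ last    = trans (repeatedAtMost-∷ʳ s x v) (cong (_∨ (occurs s x ∧ not (v <ᵇ x))) (proj₁ (∧-true last)))

lastOf : ℕ → List ℕ → ℕ
lastOf y []      = y
lastOf y (z ∷ σ) = lastOf z σ

lastOf-∷ʳ : ∀ y σ x → lastOf y (σ ∷ʳ x) ≡ x
lastOf-∷ʳ y []      x = refl
lastOf-∷ʳ y (z ∷ σ) x = lastOf-∷ʳ z σ x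

asc-∷ʳ : ∀ y σ x → asc (y ∷ σ ∷ʳ x) ≡ asc (y ∷ σ) + indicator (lastOf y σ <ᵇ x)
asc-∷ʳ y []      x = +-identityʳ _
asc-∷ʳ y (z ∷ σ) x = trans (cong (indicator (y <ᵇ z) +_) (asc-∷ʳ z σ x)) (sym (+-assoc (indicator (y <ᵇ z)) _ _))

asc-∷ʳ-≤ : ∀ y σ x → asc (y ∷ σ ∷ʳ x) ≤ asc (y ∷ σ) + 1
asc-∷ʳ-≤ y σ x = subst (_≤ asc (y ∷ σ) + 1) (sym (asc-∷ʳ y σ x)) (+-monoʳ-≤ (asc (y ∷ σ)) (indicator≤1 (lastOf y σ <ᵇ x)))
  where
  indicator≤1 : ∀ b → indicator b ≤ 1
  indicator≤1 true  = ≤-refl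
  indicator≤1 false = z≤n

ascentTail-∷ʳ : ∀ y a σ x → ascentTail y a (σ ∷ʳ x) ≡ (ascentTail y a σ ∧ (x <ᵇ 2 + (a + asc (y ∷ σ))))
ascentTail-∷ʳ y a []      x = trans (∧-identityʳ _) (cong (λ n → x <ᵇ 2 + n) (sym (+-identityʳ a)))
ascentTail-∷ʳ y a (z ∷ σ) x = begin
  z-ok ∧ ascentTail z a′ (σ ∷ʳ x)                             ≡⟨ cong (z-ok ∧_) (ascentTail-∷ʳ z a′ σ x) ⟩
  z-ok ∧ (ascentTail z a′ σ ∧ (x <ᵇ 2 + (a′ + asc (z ∷ σ))))  ≡⟨ ∧-assoc z-ok _ _ ⟨
  (z-ok ∧ ascentTail z a′ σ) ∧ (x <ᵇ 2 + (a′ + asc (z ∷ σ)))  ≡⟨ cong (λ n → (z-ok ∧ ascentTail z a′ σ) ∧ (x <ᵇ 2 + n))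
                                                                    (a′-+ (y <ᵇ z)) ⟩
  (z-ok ∧ ascentTail z a′ σ) ∧ (x <ᵇ 2 + (a + asc (y ∷ z ∷ σ))) ∎
  where
  z-ok : Bool
  z-ok = z <ᵇ 2 + a
  a′ : ℕ
  a′ = if y <ᵇ z then suc a else a
  a′-+ : ∀ b → (if b then suc a else a) + asc (z ∷ σ) ≡ a + (indicator b + asc (z ∷ σ))
  a′-+ true  = sym (+-suc a _)
  a′-+ false = refl

isAscentSeq-∷ʳ : ∀ y σ x → isAscentSeq (y ∷ σ ∷ʳ x) ≡ (isAscentSeq (y ∷ σ) ∧ (x <ᵇ 2 + asc (y ∷ σ)))
isAscentSeq-∷ʳ y σ x = trans (cong ((y ≡ᵇ 0) ∧_) (ascentTail-∷ʳ y 0 σ x)) (sym (∧-assoc (y ≡ᵇ 0) _ _))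

count : (List ℕ → Bool) → List (List ℕ) → ℕ
count p = sum ∘ map (indicator ∘ p)

length-filter≡count : ∀ p xss → length (filter (λ xs → T? (p xs)) xss) ≡ count p xss
length-filter≡count p []         = refl
length-filter≡count p (xs ∷ xss) with p xs
... | true  = cong suc (length-filter≡count p xss)
... | false = length-filter≡count p xss

count-++ : ∀ p xss yss → count p (xss ++ yss) ≡ count p xss + count p yss
count-++ p xss yss = trans (cong sum (map-++ (indicator ∘ p) xss yss)) (sum-++ (map (indicator ∘ p) xss) _)

count-concat : ∀ p xsss → count p (concat xsss) ≡ sum (map (count p) xsss)
count-concat p []           = refl
count-concat p (xss ∷ xsss) = trans (count-++ p xss (concat xsss)) (cong (count p xss +_) (count-concat p xsss))

count-map : ∀ p (f : List ℕ → List ℕ) xss → count p (map f xss) ≡ count (p ∘ f) xss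
count-map p f xss = cong sum (sym (map-∘ xss))

count-cong : ∀ {p q} → p ≗ q → ∀ xss → count p xss ≡ count q xss
count-cong p≗q xss = cong sum (map-cong (cong indicator ∘ p≗q) xss)

count-false : ∀ {p} → (∀ xs → p xs ≡ false) → ∀ xss → count p xss ≡ 0
count-false p≡false []         = refl
count-false p≡false (xs ∷ xss) rewrite p≡false xs = count-false p≡false xss

sum-upTo-suc : ∀ f b → sum (map f (upTo (suc b))) ≡ sum (map f (upTo b)) + f b
sum-upTo-suc f b = begin
  sum (map f (upTo (suc b)))            ≡⟨ cong (sum ∘ map f) (upTo-∷ʳ b) ⟨
  sum (map f (upTo b ∷ʳ b))             ≡⟨ cong sum (map-++ f (upTo b) (b ∷ [])) ⟩
  sum (map f (upTo b) ++ f b ∷ [])      ≡⟨ sum-++ (map f (upTo b)) (f b ∷ []) ⟩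
  sum (map f (upTo b)) + (f b + 0)      ≡⟨ cong (sum (map f (upTo b)) +_) (+-identityʳ (f b)) ⟩
  sum (map f (upTo b)) + f b            ∎

completions : (List ℕ → Bool) → ℕ → List ℕ → ℕ → ℕ
completions P b s r = count (λ xs → P (s ++ xs)) (allLists r b)

completions-zero : ∀ P b s → completions P b s 0 ≡ indicator (P s)
completions-zero P b s = trans (+-identityʳ _) (cong (indicator ∘ P) (++-identityʳ s))

completions-suc : ∀ P b s r →
  completions P b s (suc r) ≡ sum (map (λ x → completions P b (s ∷ʳ x) r) (upTo b))
completions-suc P b s r = begin
  count p (concat (map (λ x → map (x ∷_) (allLists r b)) (upTo b)))
    ≡⟨ count-concat p (map (λ x → map (x ∷_) (allLists r b)) (upTo b)) ⟩
  sum (map (count p) (map (λ x → map (x ∷_) (allLists r b)) (upTo b)))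
    ≡⟨ cong sum (map-∘ (upTo b)) ⟨
  sum (map (λ x → count p (map (x ∷_) (allLists r b))) (upTo b))
    ≡⟨ cong sum (map-cong first-letter (upTo b)) ⟩
  sum (map (λ x → completions P b (s ∷ʳ x) r) (upTo b))
    ∎
  where
  p : List ℕ → Bool
  p xs = P (s ++ xs)
  first-letter : ∀ x → count p (map (x ∷_) (allLists r b)) ≡ completions P b (s ∷ʳ x) r
  first-letter x = trans (count-map p (x ∷_) (allLists r b))
    (count-cong (λ xs → cong P (sym (++-assoc s (x ∷ []) xs))) (allLists r b))

completions-of-invalid : ∀ {P V : List ℕ → Bool} →
  (∀ s → P s ≡ true → V s ≡ true) →
  (∀ y σ x → V (y ∷ σ ∷ʳ x) ≡ true → V (y ∷ σ) ≡ true) →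
  ∀ b y σ r → V (y ∷ σ) ≡ false → completions P b (y ∷ σ) r ≡ 0
completions-of-invalid {P} {V} P⇒V V-∷ʳ b y σ r invalid =
  count-false (λ xs → ¬-not (λ P≡true → invalid⇒⊥ (V-prefix xs σ (P⇒V _ P≡true)))) (allLists r b)
  where
  V-prefix : ∀ xs σ → V (y ∷ σ ++ xs) ≡ true → V (y ∷ σ) ≡ true
  V-prefix []       σ valid = subst (λ s → V (y ∷ s) ≡ true) (++-identityʳ σ) valid
  V-prefix (x ∷ xs) σ valid =
    V-∷ʳ y σ x (V-prefix xs (σ ∷ʳ x) (subst (λ s → V (y ∷ s) ≡ true) (sym (++-assoc σ (x ∷ []) xs)) valid))
  invalid⇒⊥ : V (y ∷ σ) ≡ true → ⊥
  invalid⇒⊥ valid with () ← trans (sym invalid) valid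

-- Bottoms of forbidden runs

-- runStart x is the least y ≤ x such that F holds on all of y, …, x - 1.
module RunStart (F : ℕ → Bool) where

  runStart : ℕ → ℕ
  runStart zero    = 0
  runStart (suc y) = if F y then runStart y else suc y

  runStart-≤ : ∀ y → runStart y ≤ y
  runStart-≤ zero    = z≤n
  runStart-≤ (suc y) with F y
  ... | true  = m≤n⇒m≤1+n (runStart-≤ y)
  ... | false = ≤-refl

  runStart-run : ∀ {y z} → runStart y ≤ z → z < y → F z ≡ true
  runStart-run {suc y} {z} start≤z z<1+y with F y in Fy
  ... | false = ⊥-elim (<-irrefl refl (<-≤-trans z<1+y start≤z))
  ... | true  with m≤n⇒m<n∨m≡n (s≤s⁻¹ z<1+y)
  ...   | inj₁ z<y  = runStart-run {y} start≤z z<y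
  ...   | inj₂ refl = Fy

  runStart-boundary : ∀ {y k} → runStart y ≡ suc k → F k ≡ false
  runStart-boundary {suc y} eq with F y in Fy
  ... | true  = runStart-boundary {y} eq
  ... | false with refl ← suc-injective eq = Fy

  runStart-fixed : ∀ {y} → (∀ {k} → y ≡ suc k → F k ≡ false) → runStart y ≡ y
  runStart-fixed {zero}  _        = refl
  runStart-fixed {suc y} boundary rewrite boundary refl = refl

  runStart-ascent : ∀ {ℓ ℓ′} x → ℓ′ ≤ ℓ → (∀ {z} → ℓ′ ≤ z → z < ℓ → F z ≡ true) → F ℓ ≡ false →
    (ℓ <ᵇ x) ≡ (ℓ′ <ᵇ runStart x)
  runStart-ascent {ℓ} {ℓ′} x ℓ′≤ℓ gap Fℓ with ℓ <ᵇ x in ℓ<ᵇx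
  ... | true  = sym (<ᵇ-true (≤-<-trans ℓ′≤ℓ (≰⇒> start≰ℓ)))
    where
    start≰ℓ : runStart x ≰ ℓ
    start≰ℓ start≤ℓ = true≢false (trans (sym (runStart-run {x} start≤ℓ (<ᵇ-true⁻¹ ℓ<ᵇx))) Fℓ)
  ... | false with runStart x in start≡
  ...   | zero  = refl
  ...   | suc k = sym (<ᵇ-false (≮⇒≥ ℓ′≮1+k))
    where
    ℓ′≮1+k : ℓ′ ≮ suc k
    ℓ′≮1+k ℓ′<1+k = true≢false (trans (sym (gap (s≤s⁻¹ ℓ′<1+k) k<ℓ)) (runStart-boundary {x} start≡))
      where
      k<ℓ : k < ℓ
      k<ℓ = ≤-trans (≤-reflexive (sym start≡)) (≤-trans (runStart-≤ x) (<ᵇ-false⁻¹ ℓ<ᵇx))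

  -- runStart maps {x | F x ≡ false} bijectively onto {0} ∪ {suc k | F k ≡ false},
  -- so tA and tB have the same sum as soon as tB vanishes off this image.
  sum-runStart : (tA tB : ℕ → ℕ) →
    (∀ {x} → F x ≡ true → tA x ≡ 0) →
    (∀ {x} → F x ≡ false → tA x ≡ tB (runStart x)) →
    (∀ {x} → F x ≡ true → tB (suc x) ≡ 0) →
    ∀ {b} → F b ≡ false → sum (map tA (upTo (suc b))) ≡ sum (map tB (upTo (suc b)))
  sum-runStart tA tB tA-run tA-start tB-run {b} Fb = begin
    sum (map tA (upTo (suc b)))              ≡⟨ sum-upTo-suc tA b ⟩
    sum (map tA (upTo b)) + tA b             ≡⟨ cong (sum (map tA (upTo b)) +_) (tA-start Fb) ⟩
    sum (map tA (upTo b)) + tB (runStart b)  ≡⟨ prefix-sums b ⟩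
    sum (map tB (upTo (suc b)))              ∎
    where
    prefix-sums : ∀ b → sum (map tA (upTo b)) + tB (runStart b) ≡ sum (map tB (upTo (suc b)))
    prefix-sums zero    = sym (+-identityʳ (tB 0))
    prefix-sums (suc b) with F b in Fb
    ... | true = begin
      sum (map tA (upTo (suc b))) + tB (runStart b)      ≡⟨ cong (_+ tB (runStart b)) (sum-upTo-suc tA b) ⟩
      sum (map tA (upTo b)) + tA b + tB (runStart b)     ≡⟨ cong (λ n → sum (map tA (upTo b)) + n + tB (runStart b)) (tA-run Fb) ⟩
      sum (map tA (upTo b)) + 0 + tB (runStart b)        ≡⟨ cong (_+ tB (runStart b)) (+-identityʳ _) ⟩
      sum (map tA (upTo b)) + tB (runStart b)            ≡⟨ prefix-sums b ⟩
      sum (map tB (upTo (suc b)))                        ≡⟨ +-identityʳ _ ⟨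
      sum (map tB (upTo (suc b))) + 0                    ≡⟨ cong (sum (map tB (upTo (suc b))) +_) (tB-run Fb) ⟨
      sum (map tB (upTo (suc b))) + tB (suc b)           ≡⟨ sum-upTo-suc tB (suc b) ⟨
      sum (map tB (upTo (2 + b)))                        ∎
    ... | false = begin
      sum (map tA (upTo (suc b))) + tB (suc b)                   ≡⟨ cong (_+ tB (suc b)) (sum-upTo-suc tA b) ⟩
      sum (map tA (upTo b)) + tA b + tB (suc b)                  ≡⟨ cong (λ n → sum (map tA (upTo b)) + n + tB (suc b)) (tA-start Fb) ⟩
      sum (map tA (upTo b)) + tB (runStart b) + tB (suc b)       ≡⟨ cong (_+ tB (suc b)) (prefix-sums b) ⟩
      sum (map tB (upTo (suc b))) + tB (suc b)                   ≡⟨ sum-upTo-suc tB (suc b) ⟨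
      sum (map tB (upTo (2 + b)))                                ∎

-- The letter-by-letter bijection

-- The invariant of the map sending σ to τ letter by letter, x ↦ runStart (forbiddenA (0 ∷ σ′)) x
-- where σ′ is the part of σ before x.
record Related (σ τ : List ℕ) : Set where
  field
    ascentSeqA    : isAscentSeq (0 ∷ σ) ≡ true
    avoidsA       : containsA (0 ∷ σ) ≡ false
    ascentSeqB    : isAscentSeq (0 ∷ τ) ≡ true
    avoidsB       : containsB (0 ∷ τ) ≡ false
    asc≡          : asc (0 ∷ σ) ≡ asc (0 ∷ τ)
    forbidden≡    : ∀ v → forbiddenA (0 ∷ σ) v ≡ forbiddenA (0 ∷ τ) v
    repeated≡     : ∀ v → repeatedAtMost (0 ∷ σ) v ≡ repeatedAtMost (0 ∷ τ) v
    occurs≡       : ∀ {v} → repeatedAtMost (0 ∷ σ) v ≡ false → occurs (0 ∷ σ) v ≡ occurs (0 ∷ τ) v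
    forbidden≤asc : ∀ {v} → forbiddenA (0 ∷ σ) v ≡ true → v ≤ asc (0 ∷ σ)
    last≤last     : lastOf 0 τ ≤ lastOf 0 σ
    between-lasts : ∀ {z} → lastOf 0 τ ≤ z → z < lastOf 0 σ → forbiddenA (0 ∷ σ) z ≡ true
    last-allowed  : forbiddenA (0 ∷ σ) (lastOf 0 σ) ≡ false

related-[] : Related [] []
related-[] = record
  { ascentSeqA = refl ; avoidsA = refl ; ascentSeqB = refl ; avoidsB = refl ; asc≡ = refl
  ; forbidden≡ = λ _ → refl ; repeated≡ = λ _ → refl ; occurs≡ = λ _ → refl
  ; forbidden≤asc = λ () ; last≤last = z≤n ; between-lasts = λ _ () ; last-allowed = refl }

module Step {σ τ} (rel : Related σ τ) {x}
            (allowed : forbiddenA (0 ∷ σ) x ≡ false) (bounded : (x <ᵇ 2 + asc (0 ∷ σ)) ≡ true) where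

  open Related rel
  open RunStart (forbiddenA (0 ∷ σ))

  s t : List ℕ
  s = 0 ∷ σ
  t = 0 ∷ τ

  w : ℕ
  w = runStart x

  w≤x : w ≤ x
  w≤x = runStart-≤ x

  x≤1+asc : x ≤ suc (asc s)
  x≤1+asc = s≤s⁻¹ (<ᵇ-true⁻¹ bounded)

  -- If w < x then w is forbidden, so some letter ≤ w is already repeated.
  below-w : w ≢ x → ∀ {v} → repeatedAtMost s v ≡ false → v < w
  below-w w≢x {v} none = ≰⇒> w≰v
    where
    w≰v : w ≰ v
    w≰v w≤v = true≢false (trans (sym (repeatedAtMost-mono s w≤v repeated-w)) none)
      where
      repeated-w : repeatedAtMost s w ≡ true
      repeated-w = forbiddenA⇒repeatedAtMost s (runStart-run {x} ≤-refl (≤∧≢⇒< w≤x w≢x))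

  <ᵇx≡<ᵇw : ∀ {v} → forbiddenA s v ≡ false → (v <ᵇ x) ≡ (v <ᵇ w)
  <ᵇx≡<ᵇw {v} Fv with v <ᵇ w in v<ᵇw
  ... | true  = <ᵇ-true (<-≤-trans (<ᵇ-true⁻¹ v<ᵇw) w≤x)
  ... | false = <ᵇ-false (≮⇒≥ v≮x)
    where
    v≮x : v ≮ x
    v≮x v<x = true≢false (trans (sym (runStart-run {x} (<ᵇ-false⁻¹ v<ᵇw) v<x)) Fv)

  w-allowedB : forbiddenB t w ≡ false
  w-allowedB with runStart x in w≡
  ... | zero  = forbiddenB-zero t
  ... | suc k = trans (forbiddenB-suc t k) (trans (sym (forbidden≡ k)) (runStart-boundary {x} w≡))

  new-repeat≡ : ∀ {v} → repeatedAtMost s v ≡ false → (occurs s x ∧ not (v <ᵇ x)) ≡ (occurs t w ∧ not (v <ᵇ w))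
  new-repeat≡ {v} none with w ≟ x
  ... | no w≢x = begin
    occurs s x ∧ not (v <ᵇ x)  ≡⟨ cong (λ b → occurs s x ∧ not b) (<ᵇ-true (<-≤-trans (below-w w≢x none) w≤x)) ⟩
    occurs s x ∧ false         ≡⟨ ∧-zeroʳ _ ⟩
    false                      ≡⟨ ∧-zeroʳ _ ⟨
    occurs t w ∧ false         ≡⟨ cong (λ b → occurs t w ∧ not b) (<ᵇ-true (below-w w≢x none)) ⟨
    occurs t w ∧ not (v <ᵇ w)  ∎
  ... | yes w≡x rewrite w≡x with v <ᵇ x in v<ᵇx
  ...   | true  = trans (∧-zeroʳ (occurs s x)) (sym (∧-zeroʳ (occurs t x)))
  ...   | false = cong (_∧ true) (occurs≡ (repeatedAtMost-antimono s (<ᵇ-false⁻¹ v<ᵇx) none))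

  new-letter≡ : ∀ {v} → repeatedAtMost s v ≡ false → (x ≡ᵇ v) ≡ (w ≡ᵇ v)
  new-letter≡ {v} none with w ≟ x
  ... | yes w≡x = cong (_≡ᵇ v) (sym w≡x)
  ... | no  w≢x = trans (≡ᵇ-false (λ x≡v → <-irrefl (sym x≡v) (<-≤-trans v<w w≤x)))
                        (sym (≡ᵇ-false (λ w≡v → <-irrefl (sym w≡v) v<w)))
    where
    v<w : v < w
    v<w = below-w w≢x none

  related : Related (σ ∷ʳ x) (τ ∷ʳ w)
  related = record
    { ascentSeqA    = trans (isAscentSeq-∷ʳ 0 σ x) (cong₂ _∧_ ascentSeqA bounded)
    ; avoidsA       = trans (containsA-∷ʳ s x) (cong₂ _∨_ avoidsA allowed)
    ; ascentSeqB    = trans (isAscentSeq-∷ʳ 0 τ w) (cong₂ _∧_ ascentSeqB w-bounded)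
    ; avoidsB       = trans (containsB-∷ʳ t w) (cong₂ _∨_ avoidsB w-allowedB)
    ; asc≡          = asc-∷ʳ≡
    ; forbidden≡    = forbidden-∷ʳ≡
    ; repeated≡     = repeated-∷ʳ≡
    ; occurs≡       = occurs-∷ʳ≡
    ; forbidden≤asc = forbidden-∷ʳ≤asc
    ; last≤last     = subst₂ _≤_ (sym (lastOf-∷ʳ 0 τ w)) (sym (lastOf-∷ʳ 0 σ x)) w≤x
    ; between-lasts = between-lasts-∷ʳ
    ; last-allowed  = last-allowed-∷ʳ
    }
    where
    w-bounded : (w <ᵇ 2 + asc t) ≡ true
    w-bounded = <ᵇ-true (≤-<-trans w≤x (subst (λ a → x < 2 + a) asc≡ (<ᵇ-true⁻¹ bounded)))

    asc-∷ʳ≡ : asc (s ∷ʳ x) ≡ asc (t ∷ʳ w)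
    asc-∷ʳ≡ = begin
      asc (s ∷ʳ x)                                 ≡⟨ asc-∷ʳ 0 σ x ⟩
      asc s + indicator (lastOf 0 σ <ᵇ x)          ≡⟨ cong₂ _+_ asc≡ (cong indicator
                                                        (runStart-ascent x last≤last between-lasts last-allowed)) ⟩
      asc t + indicator (lastOf 0 τ <ᵇ w)          ≡⟨ asc-∷ʳ 0 τ w ⟨
      asc (t ∷ʳ w)                                 ∎

    forbidden-∷ʳ≡ : ∀ v → forbiddenA (s ∷ʳ x) v ≡ forbiddenA (t ∷ʳ w) v
    forbidden-∷ʳ≡ v = begin
      forbiddenA (s ∷ʳ x) v                                      ≡⟨ forbiddenA-∷ʳ s x v ⟩
      forbiddenA s v ∨ (repeatedAtMost s v ∧ (v <ᵇ x))           ≡⟨ ∨-congʳ-false (cong (repeatedAtMost s v ∧_) ∘ <ᵇx≡<ᵇw) ⟩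
      forbiddenA s v ∨ (repeatedAtMost s v ∧ (v <ᵇ w))           ≡⟨ cong₂ (λ f r → f ∨ (r ∧ (v <ᵇ w))) (forbidden≡ v) (repeated≡ v) ⟩
      forbiddenA t v ∨ (repeatedAtMost t v ∧ (v <ᵇ w))           ≡⟨ forbiddenA-∷ʳ t w v ⟨
      forbiddenA (t ∷ʳ w) v                                      ∎

    repeated-∷ʳ≡ : ∀ v → repeatedAtMost (s ∷ʳ x) v ≡ repeatedAtMost (t ∷ʳ w) v
    repeated-∷ʳ≡ v = begin
      repeatedAtMost (s ∷ʳ x) v                                  ≡⟨ repeatedAtMost-∷ʳ s x v ⟩
      repeatedAtMost s v ∨ (occurs s x ∧ not (v <ᵇ x))           ≡⟨ ∨-congʳ-false new-repeat≡ ⟩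
      repeatedAtMost s v ∨ (occurs t w ∧ not (v <ᵇ w))           ≡⟨ cong (_∨ (occurs t w ∧ not (v <ᵇ w))) (repeated≡ v) ⟩
      repeatedAtMost t v ∨ (occurs t w ∧ not (v <ᵇ w))           ≡⟨ repeatedAtMost-∷ʳ t w v ⟨
      repeatedAtMost (t ∷ʳ w) v                                  ∎

    occurs-∷ʳ≡ : ∀ {v} → repeatedAtMost (s ∷ʳ x) v ≡ false → occurs (s ∷ʳ x) v ≡ occurs (t ∷ʳ w) v
    occurs-∷ʳ≡ {v} none-∷ʳ = begin
      occurs (s ∷ʳ x) v       ≡⟨ occurs-∷ʳ s x v ⟩
      occurs s v ∨ (x ≡ᵇ v)   ≡⟨ cong₂ _∨_ (occurs≡ none) (new-letter≡ none) ⟩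
      occurs t v ∨ (w ≡ᵇ v)   ≡⟨ occurs-∷ʳ t w v ⟨
      occurs (t ∷ʳ w) v       ∎
      where
      none : repeatedAtMost s v ≡ false
      none = ∨-false (trans (sym (repeatedAtMost-∷ʳ s x v)) none-∷ʳ)

    forbidden-∷ʳ≤asc : ∀ {v} → forbiddenA (s ∷ʳ x) v ≡ true → v ≤ asc (s ∷ʳ x)
    forbidden-∷ʳ≤asc {v} forbidden = ≤-trans v≤asc (subst (asc s ≤_) (sym (asc-∷ʳ 0 σ x)) (m≤m+n (asc s) _))
      where
      v≤asc : v ≤ asc s
      v≤asc with ∨-true (trans (sym (forbiddenA-∷ʳ s x v)) forbidden)
      ... | inj₁ earlier = forbidden≤asc earlier
      ... | inj₂ late    = s≤s⁻¹ (<-≤-trans (<ᵇ-true⁻¹ (proj₂ (∧-true {repeatedAtMost s v} late))) x≤1+asc)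

    between-lasts-∷ʳ : ∀ {z} → lastOf 0 (τ ∷ʳ w) ≤ z → z < lastOf 0 (σ ∷ʳ x) → forbiddenA (s ∷ʳ x) z ≡ true
    between-lasts-∷ʳ {z} w≤z z<x rewrite lastOf-∷ʳ 0 τ w | lastOf-∷ʳ 0 σ x =
      trans (forbiddenA-∷ʳ s x z) (cong (_∨ (repeatedAtMost s z ∧ (z <ᵇ x))) (runStart-run {x} w≤z z<x))

    last-allowed-∷ʳ : forbiddenA (s ∷ʳ x) (lastOf 0 (σ ∷ʳ x)) ≡ false
    last-allowed-∷ʳ rewrite lastOf-∷ʳ 0 σ x = trans (forbiddenA-∷ʳ s x x)
      (cong₂ _∨_ allowed (trans (cong (repeatedAtMost s x ∧_) (<ᵇ-irrefl x)) (∧-zeroʳ _)))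

module AvoidanceClass (u v : List ℕ) (forbidden : List ℕ → ℕ → Bool)
  (avoids-∷ʳ : ∀ s x → (contains (s ∷ʳ x) u ∨ contains (s ∷ʳ x) v) ≡ ((contains s u ∨ contains s v) ∨ forbidden s x))
  where

  counted : ℕ → List ℕ → Bool
  counted m l = isAscentSeq l ∧ (asc l ≡ᵇ m) ∧ not (contains l u) ∧ not (contains l v)

  valid : List ℕ → Bool
  valid l = isAscentSeq l ∧ not (contains l u ∨ contains l v)

  counted-valid : ∀ {m} l → isAscentSeq l ≡ true → (contains l u ∨ contains l v) ≡ false → counted m l ≡ (asc l ≡ᵇ m)
  counted-valid {m} l = go {isAscentSeq l} {asc l ≡ᵇ m} {contains l u} {contains l v}
    where
    go : ∀ {i a c d} → i ≡ true → (c ∨ d) ≡ false → (i ∧ a ∧ not c ∧ not d) ≡ a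
    go {true} {a} {false} {false} _ _ = ∧-identityʳ a

  counted⇒valid : ∀ {m} l → counted m l ≡ true → valid l ≡ true
  counted⇒valid {m} l = go {isAscentSeq l} {asc l ≡ᵇ m} {contains l u} {contains l v}
    where
    go : ∀ {i a c d} → (i ∧ a ∧ not c ∧ not d) ≡ true → (i ∧ not (c ∨ d)) ≡ true
    go {true} {true} {false} {false} _ = refl

  valid-∷ʳ : ∀ y σ x → valid (y ∷ σ ∷ʳ x) ≡ true → valid (y ∷ σ) ≡ true
  valid-∷ʳ y σ x valid-∷ʳx =
    go {isAscentSeq (y ∷ σ)} {x <ᵇ 2 + asc (y ∷ σ)} {contains (y ∷ σ) u ∨ contains (y ∷ σ) v} {forbidden (y ∷ σ) x}
       (trans (sym (cong₂ (λ i c → i ∧ not c) (isAscentSeq-∷ʳ y σ x) (avoids-∷ʳ (y ∷ σ) x))) valid-∷ʳx)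
    where
    go : ∀ {i b c f} → ((i ∧ b) ∧ not (c ∨ f)) ≡ true → (i ∧ not c) ≡ true
    go {true} {true} {false} {false} _ = refl

  completions-of-invalid-prefix : ∀ m b y σ r → valid (y ∷ σ) ≡ false → completions (counted m) b (y ∷ σ) r ≡ 0
  completions-of-invalid-prefix m = completions-of-invalid counted⇒valid valid-∷ʳ

module A = AvoidanceClass p0010 p0021 forbiddenA containsA-∷ʳ
module B = AvoidanceClass p0011 p0021 forbiddenB containsB-∷ʳ

-- The bound asc + r < b keeps the largest letter b - 1 from being forbidden, as sum-runStart requires.
completionsA≡completionsB : ∀ m b r {σ τ} → Related σ τ → asc (0 ∷ σ) + r < b →
  completions (A.counted m) b (0 ∷ σ) r ≡ completions (B.counted m) b (0 ∷ τ) r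
completionsA≡completionsB m b zero {σ} {τ} rel _ = begin
  completions (A.counted m) b (0 ∷ σ) 0  ≡⟨ completions-zero (A.counted m) b (0 ∷ σ) ⟩
  indicator (A.counted m (0 ∷ σ))        ≡⟨ cong indicator countedA≡ ⟩
  indicator (asc (0 ∷ σ) ≡ᵇ m)           ≡⟨ cong (λ a → indicator (a ≡ᵇ m)) asc≡ ⟩
  indicator (asc (0 ∷ τ) ≡ᵇ m)           ≡⟨ cong indicator countedB≡ ⟨
  indicator (B.counted m (0 ∷ τ))        ≡⟨ completions-zero (B.counted m) b (0 ∷ τ) ⟨
  completions (B.counted m) b (0 ∷ τ) 0  ∎
  where
  open Related rel
  countedA≡ : A.counted m (0 ∷ σ) ≡ (asc (0 ∷ σ) ≡ᵇ m)
  countedA≡ = A.counted-valid (0 ∷ σ) ascentSeqA avoidsA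
  countedB≡ : B.counted m (0 ∷ τ) ≡ (asc (0 ∷ τ) ≡ᵇ m)
  countedB≡ = B.counted-valid (0 ∷ τ) ascentSeqB avoidsB
completionsA≡completionsB m (suc b) (suc r) {σ} {τ} rel bound = begin
  completions (A.counted m) (suc b) s (suc r)  ≡⟨ completions-suc (A.counted m) (suc b) s r ⟩
  sum (map tA (upTo (suc b)))                  ≡⟨ sum-runStart tA tB tA-run tA-start tB-run b-allowed ⟩
  sum (map tB (upTo (suc b)))                  ≡⟨ completions-suc (B.counted m) (suc b) t r ⟨
  completions (B.counted m) (suc b) t (suc r)  ∎
  where
  open Related rel
  open RunStart (forbiddenA (0 ∷ σ))

  s t : List ℕ
  s = 0 ∷ σ
  t = 0 ∷ τ

  tA tB : ℕ → ℕ
  tA x = completions (A.counted m) (suc b) (s ∷ʳ x) r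
  tB y = completions (B.counted m) (suc b) (t ∷ʳ y) r

  asc<b : asc s < b
  asc<b = <-≤-trans (m<m+n (asc s) z<s) (s≤s⁻¹ bound)

  b-allowed : forbiddenA s b ≡ false
  b-allowed = ¬-not (λ forbidden → ≤⇒≯ (forbidden≤asc forbidden) asc<b)

  tA-run : ∀ {x} → forbiddenA s x ≡ true → tA x ≡ 0
  tA-run {x} forbidden = A.completions-of-invalid-prefix m (suc b) 0 (σ ∷ʳ x) r (∧-not-true {isAscentSeq (s ∷ʳ x)}
    (trans (containsA-∷ʳ s x) (trans (cong (containsA s ∨_) forbidden) (∨-zeroʳ (containsA s)))))

  tB-run : ∀ {x} → forbiddenA s x ≡ true → tB (suc x) ≡ 0
  tB-run {x} forbidden = B.completions-of-invalid-prefix m (suc b) 0 (τ ∷ʳ suc x) r (∧-not-true {isAscentSeq (t ∷ʳ suc x)}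
    (trans (containsB-∷ʳ t (suc x)) (trans (cong (containsB t ∨_) forbiddenB-t) (∨-zeroʳ (containsB t)))))
    where
    forbiddenB-t : forbiddenB t (suc x) ≡ true
    forbiddenB-t = trans (forbiddenB-suc t x) (trans (sym (forbidden≡ x)) forbidden)

  tA-start : ∀ {x} → forbiddenA s x ≡ false → tA x ≡ tB (runStart x)
  tA-start {x} allowed with x <ᵇ 2 + asc s in bounded
  ... | true  = completionsA≡completionsB m (suc b) r (Step.related rel allowed bounded)
                  (≤-<-trans (+-monoˡ-≤ r (asc-∷ʳ-≤ 0 σ x)) (subst (_< suc b) (sym (+-assoc (asc s) 1 r)) bound))
  ... | false = begin
    tA x              ≡⟨ A.completions-of-invalid-prefix m (suc b) 0 (σ ∷ʳ x) r (cong (_∧ not (containsA (s ∷ʳ x))) ascentA) ⟩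
    0                 ≡⟨ B.completions-of-invalid-prefix m (suc b) 0 (τ ∷ʳ x) r (cong (_∧ not (containsB (t ∷ʳ x))) ascentB) ⟨
    tB x              ≡⟨ cong tB (runStart-fixed below-x-allowed) ⟨
    tB (runStart x)   ∎
    where
    ascentA : isAscentSeq (s ∷ʳ x) ≡ false
    ascentA = trans (isAscentSeq-∷ʳ 0 σ x) (cong₂ _∧_ ascentSeqA bounded)
    ascentB : isAscentSeq (t ∷ʳ x) ≡ false
    ascentB = trans (isAscentSeq-∷ʳ 0 τ x) (cong₂ _∧_ ascentSeqB (trans (cong (λ a → x <ᵇ 2 + a) (sym asc≡)) bounded))
    below-x-allowed : ∀ {k} → x ≡ suc k → forbiddenA s k ≡ false
    below-x-allowed {k} refl = ¬-not (λ forbidden → ≤⇒≯ (forbidden≤asc forbidden) (s≤s⁻¹ (<ᵇ-false⁻¹ bounded)))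

proposition3 : (n m : ℕ) → 1 ≤ n → m < n →
    S n m (0 ∷ 0 ∷ 1 ∷ 0 ∷ []) (0 ∷ 0 ∷ 2 ∷ 1 ∷ []) ≡ S n m (0 ∷ 0 ∷ 1 ∷ 1 ∷ []) (0 ∷ 0 ∷ 2 ∷ 1 ∷ [])
proposition3 zero    m () _
proposition3 (suc r) m _  _ = begin
  S (suc r) m p0010 p0021
    ≡⟨ length-filter≡count (A.counted m) (allLists (suc r) (suc r)) ⟩
  completions (A.counted m) (suc r) [] (suc r)
    ≡⟨ completions-suc (A.counted m) (suc r) [] r ⟩
  sum (map (λ x → completions (A.counted m) (suc r) (x ∷ []) r) (upTo (suc r)))
    ≡⟨ cong sum (map-cong first-letter (upTo (suc r))) ⟩
  sum (map (λ x → completions (B.counted m) (suc r) (x ∷ []) r) (upTo (suc r)))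
    ≡⟨ completions-suc (B.counted m) (suc r) [] r ⟨
  completions (B.counted m) (suc r) [] (suc r)
    ≡⟨ length-filter≡count (B.counted m) (allLists (suc r) (suc r)) ⟨
  S (suc r) m p0011 p0021
    ∎
  where
  first-letter : ∀ x → completions (A.counted m) (suc r) (x ∷ []) r ≡ completions (B.counted m) (suc r) (x ∷ []) r
  first-letter zero    = completionsA≡completionsB m (suc r) r related-[] ≤-refl
  first-letter (suc _) = trans (count-false (λ _ → refl) (allLists r (suc r)))
                               (sym (count-false (λ _ → refl) (allLists r (suc r))))
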